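{- Let $(\mathcal{Q},\mathcal{P})$ and $(\mathcal{S},\mathcal{R})$ be bipartite monoids (with $\mathcal{Q},\mathcal{S}$ commutative), with reductions $(\mathcal{Q}',\mathcal{P}')$ and $(\mathcal{S}',\mathcal{R}')$ and reduction maps $\pi_{\mathcal{Q}}:\mathcal{Q}\to\mathcal{Q}'$, $\pi_{\mathcal{S}}:\mathcal{S}\to\mathcal{S}'$. Suppose $f:(\mathcal{Q},\mathcal{P})\to(\mathcal{S},\mathcal{R})$ is a surjective homomorphism of bipartite monoids. Then there is an isomorphism of bipartite monoids $i:(\mathcal{Q}',\mathcal{P}')\to(\mathcal{S}',\mathcal{R}')$ with $i\circ\pi_{\mathcal{Q}}=\pi_{\mathcal{S}}\circ f$.
   Context: A bipartite monoid is a pair $(\mathcal{Q},\mathcal{P})$ with $\mathcal{Q}$ a monoid and $\mathcal{P}\subseteq\mathcal{Q}$. A homomorphism $f:(\mathcal{Q},\mathcal{P})\to(\mathcal{Q}',\mathcal{P}')$ is a monoid homomorphism with $x\in\mathcal{P}\iff f(x)\in\mathcal{P}'$ for all $x\in\mathcal{Q}$; an isomorphism is a bijective homomorphism. Elements $x,y\in\mathcal{Q}$ are indistinguishable if for all $w\in\mathcal{Q}$, $xw\in\mathcal{P}\iff yw\in\mathcal{P}$; for commutative $\mathcal{Q}$ this is a congruence $\rho$. The reduction of $(\mathcal{Q},\mathcal{P})$ is $(\mathcal{Q}/\rho,\{[x]_\rho:x\in\mathcal{P}\})$, with reduction map $x\mapsto[x]_\rho$. -}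

module Defs where

open import Level using (Level; _⊔_; suc)
open import Algebra.Bundles using (CommutativeMonoid)
open import Algebra.Morphism.Structures using (module MonoidMorphisms)
open import Function.Bundles using (_⇔_; mk⇔; Equivalence)
open import Function.Definitions using (StrictlySurjective)
open import Relation.Unary using (Pred)
open import Relation.Binary.Definitions using (_Respects_)
import Relation.Binary.Reasoning.Setoid as SetoidReasoning

record BipartiteMonoid (c ℓ p : Level) : Set (suc (c ⊔ ℓ ⊔ p)) where
  field
    commMonoid : CommutativeMonoid c ℓ
  open CommutativeMonoid commMonoid public
  field
    P      : Pred Carrier p
    P-resp : P Respects _≈_

module _ {c₁ ℓ₁ p₁ c₂ ℓ₂ p₂}
         (A : BipartiteMonoid c₁ ℓ₁ p₁) (B : BipartiteMonoid c₂ ℓ₂ p₂) where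
  private
    module A = BipartiteMonoid A
    module B = BipartiteMonoid B
  open MonoidMorphisms A.rawMonoid B.rawMonoid

  record IsBipartiteHomomorphism (f : A.Carrier → B.Carrier)
         : Set (c₁ ⊔ ℓ₁ ⊔ ℓ₂ ⊔ p₁ ⊔ p₂) where
    field
      isMonoidHomomorphism : IsMonoidHomomorphism f
      P-pres               : ∀ x → A.P x ⇔ B.P (f x)

  record IsBipartiteIsomorphism (f : A.Carrier → B.Carrier)
         : Set (c₁ ⊔ c₂ ⊔ ℓ₁ ⊔ ℓ₂ ⊔ p₁ ⊔ p₂) where
    field
      isMonoidIsomorphism : IsMonoidIsomorphism f
      P-pres              : ∀ x → A.P x ⇔ B.P (f x)

  Surjective : (A.Carrier → B.Carrier) → Set (c₁ ⊔ c₂ ⊔ ℓ₂)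
  Surjective f = StrictlySurjective B._≈_ f

module _ {c ℓ p} (A : BipartiteMonoid c ℓ p) where
  open BipartiteMonoid A

  Indistinguishable : Carrier → Carrier → Set (c ⊔ p)
  Indistinguishable x y = ∀ w → P (x ∙ w) ⇔ P (y ∙ w)

  private
    ⇔-refl : ∀ {a} {X : Set a} → X ⇔ X
    ⇔-refl = mk⇔ (λ x → x) (λ x → x)
    ⇔-sym : ∀ {a b} {X : Set a} {Y : Set b} → X ⇔ Y → Y ⇔ X
    ⇔-sym e = mk⇔ (Equivalence.from e) (Equivalence.to e)
    ⇔-trans : ∀ {a b d} {X : Set a} {Y : Set b} {Z : Set d} → X ⇔ Y → Y ⇔ Z → X ⇔ Z
    ⇔-trans e f = mk⇔ (λ x → Equivalence.to f (Equivalence.to e x))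
                      (λ z → Equivalence.from e (Equivalence.from f z))

    resp⇔ : ∀ {x y} → x ≈ y → P x ⇔ P y
    resp⇔ x≈y = mk⇔ (P-resp x≈y) (P-resp (sym x≈y))

    ≈⇒~ : ∀ {x y} → x ≈ y → Indistinguishable x y
    ≈⇒~ x≈y w = resp⇔ (∙-congʳ x≈y)

    ~-refl : ∀ {x} → Indistinguishable x x
    ~-refl w = ⇔-refl
    ~-sym : ∀ {x y} → Indistinguishable x y → Indistinguishable y x
    ~-sym e w = ⇔-sym (e w)
    ~-trans : ∀ {x y z} → Indistinguishable x y → Indistinguishable y z
            → Indistinguishable x z
    ~-trans e f w = ⇔-trans (e w) (f w)

    ~-congʳ : ∀ {x y u} → Indistinguishable x y
            → Indistinguishable (x ∙ u) (y ∙ u)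
    ~-congʳ {x} {y} {u} e w =
      ⇔-trans (resp⇔ (assoc x u w))
        (⇔-trans (e (u ∙ w)) (resp⇔ (sym (assoc y u w))))

    ~-cong : ∀ {x y u v} → Indistinguishable x y → Indistinguishable u v
           → Indistinguishable (x ∙ u) (y ∙ v)
    ~-cong {x} {y} {u} {v} e f =
      ~-trans (~-congʳ e)
        (~-trans (≈⇒~ (comm y u))
          (~-trans (~-congʳ f) (≈⇒~ (comm v y))))

  -- The reduction (Q/ρ , {[x] : x ∈ P}).  Since Agda has no quotient types,
  -- Q/ρ is represented as the setoid with the same carrier and operation,
  -- and equality ρ = indistinguishability.
  reductionMonoid : CommutativeMonoid c (c ⊔ p)
  reductionMonoid = record
    { Carrier = Carrier
    ; _≈_ = Indistinguishable
    ; _∙_ = _∙_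
    ; ε = ε
    ; isCommutativeMonoid = record
      { isMonoid = record
        { isSemigroup = record
          { isMagma = record
            { isEquivalence = record { refl = ~-refl ; sym = ~-sym ; trans = ~-trans }
            ; ∙-cong = ~-cong }
          ; assoc = λ x y z → ≈⇒~ (assoc x y z) }
        ; identity = (λ x → ≈⇒~ (identityˡ x)) , (λ x → ≈⇒~ (identityʳ x)) }
      ; comm = λ x y → ≈⇒~ (comm x y) } }
    where open import Data.Product using (_,_)

  reduction : BipartiteMonoid c (c ⊔ p) p
  reduction = record
    { commMonoid = reductionMonoid
    ; P = P
    ; P-resp = λ {x} {y} e Px →
        P-resp (identityʳ y) (Equivalence.to (e ε) (P-resp (sym (identityʳ x)) Px)) }

  reductionMap : Carrier → BipartiteMonoid.Carrier reduction
  reductionMap x = x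

{-# OPTIONS --safe #-}
module Submission where

-- The reductions share their carriers with Q and S, so f itself is the candidate i.
-- Since P (x w) ⇔ R (f x f w), the element f w tests x against y in S exactly as w
-- does in Q; hence f reflects indistinguishability, and, every test element of S
-- being of the form f w by surjectivity, it preserves it as well.

open import Defs
open import Level using (Level)
open import Data.Product using (Σ; _×_; _,_)
open import Function.Bundles using (_⇔_; mk⇔)
open import Function.Construct.Composition using (_⇔-∘_)
open import Function.Construct.Symmetry using (⇔-sym)
open import Algebra.Morphism.Structures using (module MonoidMorphisms)

⇔-transport : ∀ {a a′ b b′} {A : Set a} {A′ : Set a′} {B : Set b} {B′ : Set b′} →
              A ⇔ A′ → B ⇔ B′ → A ⇔ B → A′ ⇔ B′
⇔-transport A⇔A′ B⇔B′ A⇔B = B⇔B′ ⇔-∘ (A⇔B ⇔-∘ ⇔-sym A⇔A′)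

module _ {c ℓ p} (A : BipartiteMonoid c ℓ p) where
  open BipartiteMonoid A

  P-resp-⇔ : ∀ {x y} → x ≈ y → P x ⇔ P y
  P-resp-⇔ x≈y = mk⇔ (P-resp x≈y) (P-resp (sym x≈y))

  ≈⇒Indistinguishable : ∀ {x y} → x ≈ y → Indistinguishable A x y
  ≈⇒Indistinguishable x≈y w = P-resp-⇔ (∙-congʳ x≈y)

module _ {c₁ ℓ₁ p₁ c₂ ℓ₂ p₂}
         {Q : BipartiteMonoid c₁ ℓ₁ p₁} {S : BipartiteMonoid c₂ ℓ₂ p₂}
         {f : BipartiteMonoid.Carrier Q → BipartiteMonoid.Carrier S}
         (hom : IsBipartiteHomomorphism Q S f) where
  private
    module Q = BipartiteMonoid Q
    module S = BipartiteMonoid S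
    module Q′ = BipartiteMonoid (reduction Q)
    module S′ = BipartiteMonoid (reduction S)
    open IsBipartiteHomomorphism hom
    open MonoidMorphisms.IsMonoidHomomorphism isMonoidHomomorphism using (homo; ε-homo)

  P-∙-pres : ∀ x w → Q.P (x Q.∙ w) ⇔ S.P (f x S.∙ f w)
  P-∙-pres x w = P-resp-⇔ S (homo x w) ⇔-∘ P-pres (x Q.∙ w)

  Indistinguishable-reflect : ∀ {x y} → Indistinguishable S (f x) (f y) →
                              Indistinguishable Q x y
  Indistinguishable-reflect {x} {y} fx~fy w =
    ⇔-transport (⇔-sym (P-∙-pres x w)) (⇔-sym (P-∙-pres y w)) (fx~fy (f w))

  module _ (surj : Surjective Q S f) where

    Indistinguishable-pres : ∀ {x y} → Indistinguishable Q x y →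
                             Indistinguishable S (f x) (f y)
    Indistinguishable-pres {x} {y} x~y s with surj s
    ... | w , fw≈s =
      ⇔-transport (P-resp-⇔ S (S.∙-congˡ fw≈s)) (P-resp-⇔ S (S.∙-congˡ fw≈s))
        (⇔-transport (P-∙-pres x w) (P-∙-pres y w) (x~y w))

    reduction-isMonoidIsomorphism :
      MonoidMorphisms.IsMonoidIsomorphism Q′.rawMonoid S′.rawMonoid f
    reduction-isMonoidIsomorphism = record
      { isMonoidMonomorphism = record
        { isMonoidHomomorphism = record
          { isMagmaHomomorphism = record
            { isRelHomomorphism = record { cong = Indistinguishable-pres }
            ; homo = λ x y → ≈⇒Indistinguishable S (homo x y)
            }
          ; ε-homo = ≈⇒Indistinguishable S ε-homo
          }
        ; injective = Indistinguishable-reflect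
        }
      ; surjective = surjective
      }
      where
      surjective : ∀ s → Σ Q.Carrier λ x → ∀ {z} → Indistinguishable Q z x →
                   Indistinguishable S (f z) s
      surjective s with surj s
      ... | x , fx≈s = x , λ z~x →
        S′.trans (Indistinguishable-pres z~x) (≈⇒Indistinguishable S fx≈s)

    reduction-isBipartiteIsomorphism :
      IsBipartiteIsomorphism (reduction Q) (reduction S) f
    reduction-isBipartiteIsomorphism = record
      { isMonoidIsomorphism = reduction-isMonoidIsomorphism
      ; P-pres              = P-pres
      }

proposition3p8 : ∀ {c₁ ℓ₁ p₁ c₂ ℓ₂ p₂ : Level}
    (Q : BipartiteMonoid c₁ ℓ₁ p₁) (S : BipartiteMonoid c₂ ℓ₂ p₂)
    (f : BipartiteMonoid.Carrier Q → BipartiteMonoid.Carrier S) →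
    IsBipartiteHomomorphism Q S f → Surjective Q S f →
    Σ (BipartiteMonoid.Carrier (reduction Q) → BipartiteMonoid.Carrier (reduction S))
      (λ i → IsBipartiteIsomorphism (reduction Q) (reduction S) i
        × (∀ x → BipartiteMonoid._≈_ (reduction S) (i (reductionMap Q x)) (reductionMap S (f x))))
proposition3p8 Q S f hom surj =
  f , reduction-isBipartiteIsomorphism hom surj , λ x → BipartiteMonoid.refl (reduction S)
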